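{- Let $(X_n)_{n\ge1}$ be a sequence of finite sets with $X_1=\emptyset$ and $|X_p|=p$ for all primes $p$, and for each $n\ge1$ let the cyclic group $\mathbb{Z}_n$ act on $X_n$ such that $|X_n^i|=|X_{\gcd(s_n,i)}|$ for all $i$. Then $(X_n,\mathbb{Z}_n,S_n(q))$ exhibits the cyclic sieving phenomenon for every $n\ge1$. The same holds with $S_n(q)$ replaced by $G_n(q)$ and $s_n$ replaced by $g_n$.
   Context: For $n>1$, $s_n$ (resp. $g_n$) is the smallest (resp. greatest) prime factor of $n$, and $s_1=g_1=0$. $\Phi_k(q)$ denotes the $k$-th cyclotomic polynomial. Define $S_1(q)=G_1(q)=\Phi_1(q)=q-1$ and for $n>1$, $S_n(q)=\Phi_{s_n}(q^{n/s_n})$, $G_n(q)=\Phi_{g_n}(q^{n/g_n})$. $X_n^i$ denotes the set of points of $X_n$ fixed by $i\in\mathbb{Z}_n$. A triple $(X,\mathbb{Z}_n,f(q))$ with $\mathbb{Z}_n$ acting on the finite set $X$ and $f\in\mathbb{Z}[q]$ exhibits the cyclic sieving phenomenon if $|X^i|=f(\omega_n^i)$ for all $i\in\mathbb{Z}_n$, where $\omega_n$ is a primitive $n$-th root of unity. -}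

module Defs where

open import Level using (Level; _⊔_)
open import Data.Nat as ℕ using (ℕ; zero; suc; NonZero; _<_)
open import Data.Nat.DivMod using (_mod_; _/_)
open import Data.Nat.Divisibility using (_∣?_)
open import Data.Nat.Primality using (Prime; prime?)
open import Data.Nat.GCD using (gcd)
open import Data.Integer as ℤ using (ℤ; +_; -[1+_])
open import Data.Fin as Fin using (Fin; toℕ)
open import Data.List using (List; []; _∷_; _++_; replicate; filter; length; upTo)
open import Data.List.Base using (head; last; allFin)
open import Data.Maybe using (fromMaybe)
open import Data.Product using (_×_)
open import Data.Sum using (_⊎_)
open import Relation.Nullary using (¬_)
open import Relation.Nullary.Decidable using (_×-dec_)
open import Relation.Binary.PropositionalEquality using (_≡_)
open import Algebra.Bundles using (CommutativeRing)

-- Smallest / greatest prime factor (0 for n = 1; also 0 for n = 0,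
-- which never matters since the sequence starts at n = 1).

primeFactors : ℕ → List ℕ
primeFactors n = filter (λ d → prime? d ×-dec (d ∣? n)) (upTo (suc n))

s : ℕ → ℕ
s n = fromMaybe 0 (head (primeFactors n))

g : ℕ → ℕ
g n = fromMaybe 0 (last (primeFactors n))

-- Integer polynomials as ascending coefficient lists.

Poly : Set
Poly = List ℤ

Φ₁ : Poly
Φ₁ = -[1+ 0 ] ∷ + 1 ∷ []

-- Φ_p(q) = 1 + q + ... + q^(p-1) : the p-th cyclotomic polynomial for p prime
-- (only prime indices p = s_n, g_n with n > 1 are ever used).
Φprime : ℕ → Poly
Φprime p = replicate p (+ 1)

-- substitution q ↦ q^m  (m ≥ 1)
expand : ℕ → Poly → Poly
expand m []       = []
expand m (a ∷ as) = a ∷ (replicate (m ℕ.∸ 1) (+ 0) ++ expand m as)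

-- n / d, with junk value 0 when d = 0
quot : ℕ → ℕ → ℕ
quot n zero    = 0
quot n (suc d) = n / suc d

-- P n = Φ_{t n}(q^{n / t n}) for n > 1, and Φ_1 for n = 1
-- (t = s gives S_n, t = g gives G_n)
PolyOf : (ℕ → ℕ) → ℕ → Poly
PolyOf t 1             = Φ₁
PolyOf t n             = expand (quot n (t n)) (Φprime (t n))

S : ℕ → Poly
S = PolyOf s

G : ℕ → Poly
G = PolyOf g

-- Finite sets with a ℤ_n-action.  X_n is modelled as Fin c.
-- ℤ_n = Fin n with addition mod n.

record ZAction (n : ℕ) .{{_ : NonZero n}} (c : ℕ) : Set where
  field
    act      : Fin n → Fin c → Fin c
    act-zero : ∀ x → act (0 mod n) x ≡ x
    act-comp : ∀ i j x → act i (act j x) ≡ act ((toℕ i ℕ.+ toℕ j) mod n) x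

open ZAction public

fixCount : ∀ {n c} .{{_ : NonZero n}} → ZAction n c → Fin n → ℕ
fixCount {c = c} A i = length (filter (λ x → act A i x Fin.≟ x) (allFin c))

-- Ring-side notions.  Roots of unity are taken in an arbitrary
-- integral domain of characteristic 0 (e.g. ℂ).

module _ {a ℓ : Level} (R : CommutativeRing a ℓ) where
  open CommutativeRing R

  natR : ℕ → Carrier
  natR zero    = 0#
  natR (suc n) = 1# + natR n

  intR : ℤ → Carrier
  intR (+ n)    = natR n
  intR -[1+ n ] = - natR (suc n)

  pow : Carrier → ℕ → Carrier
  pow x zero    = 1#
  pow x (suc k) = x * pow x k

  evalPoly : Poly → Carrier → Carrier
  evalPoly []       x = 0#
  evalPoly (c ∷ cs) x = intR c + x * evalPoly cs x

  IntegralDomain : Set (a ⊔ ℓ)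
  IntegralDomain = ∀ x y → x * y ≈ 0# → x ≈ 0# ⊎ y ≈ 0#

  CharZero : Set ℓ
  CharZero = ∀ n → natR n ≈ 0# → n ≡ 0

  PrimitiveRoot : ℕ → Carrier → Set ℓ
  PrimitiveRoot n ω = pow ω n ≈ 1# × (∀ k → 0 < k → k < n → ¬ (pow ω k ≈ 1#))

  CSP : ∀ {c} n .{{_ : NonZero n}} → ZAction n c → Poly → Set (a ⊔ ℓ)
  CSP n A f = ∀ ω → PrimitiveRoot n ω →
              ∀ (i : Fin n) → natR (fixCount A i) ≈ evalPoly f (pow ω (toℕ i))

ActionSeq : (ℕ → ℕ) → Set
ActionSeq c = ∀ n .{{_ : NonZero n}} → ZAction n (c n)

FixHyp : (c : ℕ → ℕ) → ActionSeq c → (ℕ → ℕ) → Set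
FixHyp c X t = ∀ n .{{_ : NonZero n}} (i : Fin n) →
               fixCount (X n) i ≡ c (gcd (t n) (toℕ i))

{-# OPTIONS --safe #-}
module Submission where

open import Defs
open import Level using (Level)
open import Algebra.Bundles using (CommutativeRing)
open import Data.Nat as ℕ using (ℕ; NonZero; zero; suc; _<_; z≤n; z<s; s≤s; ≢-nonZero⁻¹)
import Data.Nat.Properties as ℕₚ
open import Data.Nat.Divisibility
  using (_∣_; divides; _∣?_; quotient; m∣n⇒n≡m*quotient; m%n≡0⇒n∣m; n∣m*n; ∣⇒≤; ∣-antisym; ∣-refl;
         *-monoˡ-∣; *-cancelʳ-∣)
open import Data.Nat.DivMod using (_%_; _/_; m≡m%n+[m/n]*n; m%n<n; m*[n/m]≡n)
open import Data.Nat.GCD using (gcd; gcd[m,n]∣m; gcd[m,n]∣n; gcd-greatest)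
open import Data.Nat.ListAction using (product)
open import Data.Nat.Primality using (Prime; prime?; prime⇒irreducible; prime⇒nonZero)
open import Data.Nat.Primality.Factorisation using (factorise; module PrimeFactorisation)
open import Data.Integer using (+_)
open import Data.Fin as Fin using (toℕ)
open import Data.List using ([]; _∷_; _++_; replicate; upTo; head; last)
open import Data.List.Membership.Propositional using (_∈_)
open import Data.List.Membership.Propositional.Properties using (∈-upTo⁺; ∈-filter⁺)
open import Data.List.Relation.Unary.All using (All; []; _∷_)
open import Data.List.Relation.Unary.All.Properties using (all-filter)
open import Data.List.Relation.Unary.Any using (here)
open import Data.Maybe using (fromMaybe)
open import Data.Product using (_×_; ∃; _,_; proj₁)
open import Data.Sum using (inj₁; inj₂)
open import Data.Empty using (⊥-elim)
open import Function using (_∘_)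
open import Relation.Nullary using (¬_; yes; no)
open import Relation.Nullary.Decidable using (_×-dec_)
open import Relation.Unary using (Pred)
open import Relation.Binary.PropositionalEquality using (_≡_)
import Relation.Binary.PropositionalEquality as ≡

-- Let p = s_n (or g_n) and n = p m.  At q = ω^i, Φ_p(q^m) is evaluated at y = ω^(i m), a p-th
-- root of unity.  If p ∣ i then y = 1 and Φ_p(1) = p; otherwise n = p m ∤ i m, so y ≠ 1, and since
-- (y - 1) Φ_p(y) = y^p - 1 = 0 in an integral domain, Φ_p(y) = 0.  On the other side
-- |X_n^i| = |X_gcd(p,i)| is |X_p| = p or |X_1| = 0 in the same two cases.

module _ {a p} {A : Set a} {P : Pred A p} where

  All⇒head-fromMaybe : ∀ {x xs} d → All P xs → x ∈ xs → P (fromMaybe d (head xs))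
  All⇒head-fromMaybe d (px ∷ _) _ = px

  All⇒last-fromMaybe : ∀ {x xs} d → All P xs → x ∈ xs → P (fromMaybe d (last xs))
  All⇒last-fromMaybe d (px ∷ [])            _ = px
  All⇒last-fromMaybe d (_ ∷ pxs@(_ ∷ _)) _ = All⇒last-fromMaybe d pxs (here ≡.refl)

PrimeFactorOf : ℕ → Pred ℕ _
PrimeFactorOf n p = Prime p × p ∣ n

primeFactors-sound : ∀ n → All (PrimeFactorOf n) (primeFactors n)
primeFactors-sound n = all-filter (λ d → prime? d ×-dec (d ∣? n)) (upTo (suc n))

primeFactors-complete : ∀ {n p} .{{_ : NonZero n}} → PrimeFactorOf n p → p ∈ primeFactors n
primeFactors-complete {n} pf@(_ , p∣n) =
  ∈-filter⁺ (λ d → prime? d ×-dec (d ∣? n)) (∈-upTo⁺ (s≤s (∣⇒≤ p∣n))) pf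

primeFactor-exists : ∀ n → 1 < n → ∃ (PrimeFactorOf n)
primeFactor-exists n@(suc _) 1<n = go factors isFactorisation factorsPrime
  where
  open PrimeFactorisation (factorise n)
  go : ∀ qs → n ≡ product qs → All Prime qs → ∃ (PrimeFactorOf n)
  go []       n≡1  _          = ⊥-elim (ℕₚ.<-irrefl (≡.sym n≡1) 1<n)
  go (q ∷ qs) n≡qΠ (q-prime ∷ _) = q , q-prime , divides (product qs) (≡.trans n≡qΠ (ℕₚ.*-comm q _))

s-primeFactor : ∀ n → 1 < n → PrimeFactorOf n (s n)
s-primeFactor n@(suc _) 1<n with _ , pf ← primeFactor-exists n 1<n =
  All⇒head-fromMaybe 0 (primeFactors-sound n) (primeFactors-complete pf)

g-primeFactor : ∀ n → 1 < n → PrimeFactorOf n (g n)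
g-primeFactor n@(suc _) 1<n with _ , pf ← primeFactor-exists n 1<n =
  All⇒last-fromMaybe 0 (primeFactors-sound n) (primeFactors-complete pf)

p*quot≡n : ∀ {n p} → PrimeFactorOf n p → p ℕ.* quot n p ≡ n
p*quot≡n {p = zero}  (0-prime , _) = ⊥-elim (≢-nonZero⁻¹ 0 {{prime⇒nonZero 0-prime}} ≡.refl)
p*quot≡n {p = suc _} (_ , p∣n)     = m*[n/m]≡n p∣n

cofactor-nonZero : ∀ p m {n} .{{_ : NonZero n}} → p ℕ.* m ≡ n → NonZero m
cofactor-nonZero p zero    p*0≡n = ⊥-elim (≢-nonZero⁻¹ _ (≡.trans (≡.sym p*0≡n) (ℕₚ.*-zeroʳ p)))
cofactor-nonZero p (suc _) _     = _

fixCount-empty : ∀ {n k} .{{_ : NonZero n}} (A : ZAction n k) i → k ≡ 0 → fixCount A i ≡ 0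
fixCount-empty _ _ ≡.refl = ≡.refl

m∣n⇒gcd[m,n]≡m : ∀ {m n} → m ∣ n → gcd m n ≡ m
m∣n⇒gcd[m,n]≡m m∣n = ∣-antisym (gcd[m,n]∣m _ _) (gcd-greatest ∣-refl m∣n)

prime∤⇒gcd≡1 : ∀ {p n} → Prime p → ¬ p ∣ n → gcd p n ≡ 1
prime∤⇒gcd≡1 {p} {n} p-prime p∤n with prime⇒irreducible p-prime (gcd[m,n]∣m p n)
... | inj₁ gcd≡1 = gcd≡1
... | inj₂ gcd≡p = ⊥-elim (p∤n (≡.subst (_∣ n) gcd≡p (gcd[m,n]∣n p n)))

module _ {a ℓ} (R : CommutativeRing a ℓ) where
  open CommutativeRing R
  open import Algebra.Properties.Ring ring using (x∙y⁻¹≈ε⇒x≈y; [y-z]x≈yx-zx; +-cancelʳ)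
  open import Algebra.Solver.Ring.NaturalCoefficients.Default commutativeSemiring
    using (solve; _:=_; _:+_; _:*_; con)
  open import Relation.Binary.Reasoning.Setoid setoid

  pow-cong : ∀ {x y} k → x ≈ y → pow R x k ≈ pow R y k
  pow-cong zero    _   = refl
  pow-cong (suc k) x≈y = *-cong x≈y (pow-cong k x≈y)

  pow-1# : ∀ k → pow R 1# k ≈ 1#
  pow-1# zero    = refl
  pow-1# (suc k) = trans (*-identityˡ _) (pow-1# k)

  pow-+ : ∀ x m n → pow R x (m ℕ.+ n) ≈ pow R x m * pow R x n
  pow-+ x zero    n = sym (*-identityˡ _)
  pow-+ x (suc m) n = trans (*-congˡ (pow-+ x m n)) (sym (*-assoc _ _ _))

  pow-assocʳ : ∀ x m n → pow R (pow R x m) n ≈ pow R x (m ℕ.* n)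
  pow-assocʳ x m zero    = reflexive (≡.cong (pow R x) (≡.sym (ℕₚ.*-zeroʳ m)))
  pow-assocʳ x m (suc n) = begin
    pow R x m * pow R (pow R x m) n ≈⟨ *-congˡ (pow-assocʳ x m n) ⟩
    pow R x m * pow R x (m ℕ.* n)   ≈⟨ pow-+ x m (m ℕ.* n) ⟨
    pow R x (m ℕ.+ m ℕ.* n)         ≡⟨ ≡.cong (pow R x) (ℕₚ.*-suc m n) ⟨
    pow R x (m ℕ.* suc n)           ∎

  x*y≈y⇒y≈0 : IntegralDomain R → ∀ {x y} → x * y ≈ y → ¬ x ≈ 1# → y ≈ 0#
  x*y≈y⇒y≈0 domain {x} {y} xy≈y x≉1 with domain (x - 1#) y [x-1]y≈0
    where
    [x-1]y≈0 : (x - 1#) * y ≈ 0#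
    [x-1]y≈0 = begin
      (x - 1#) * y     ≈⟨ [y-z]x≈yx-zx y x 1# ⟩
      x * y - 1# * y   ≈⟨ +-cong xy≈y (-‿cong (*-identityˡ y)) ⟩
      y - y            ≈⟨ -‿inverseʳ y ⟩
      0#               ∎
  ... | inj₁ x-1≈0 = ⊥-elim (x≉1 (x∙y⁻¹≈ε⇒x≈y x 1# x-1≈0))
  ... | inj₂ y≈0   = y≈0

  ∣⇒pow≈1 : ∀ {ω n k} → pow R ω n ≈ 1# → n ∣ k → pow R ω k ≈ 1#
  ∣⇒pow≈1 {ω} {n} {k} ωⁿ≈1 n∣k = begin
    pow R ω k                ≡⟨ ≡.cong (pow R ω) (m∣n⇒n≡m*quotient n∣k) ⟩
    pow R ω (n ℕ.* q)        ≈⟨ pow-assocʳ ω n q ⟨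
    pow R (pow R ω n) q      ≈⟨ pow-cong q ωⁿ≈1 ⟩
    pow R 1# q               ≈⟨ pow-1# q ⟩
    1#                       ∎
    where
    q : ℕ
    q = quotient n∣k

  primitive-pow≈1⇒∣ : ∀ {ω n k} .{{_ : NonZero n}} → PrimitiveRoot R n ω → pow R ω k ≈ 1# → n ∣ k
  primitive-pow≈1⇒∣ {ω} {n} {k} (ωⁿ≈1 , minimal) ωᵏ≈1 =
    m%n≡0⇒n∣m k n (below-order (k % n) (m%n<n k n) ω^[k%n]≈1)
    where
    below-order : ∀ r → r < n → pow R ω r ≈ 1# → r ≡ 0
    below-order zero    _   _     = ≡.refl
    below-order (suc r) r<n ωʳ≈1 = ⊥-elim (minimal (suc r) z<s r<n ωʳ≈1)

    ω^[k%n]≈1 : pow R ω (k % n) ≈ 1#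
    ω^[k%n]≈1 = begin
      pow R ω (k % n)                             ≈⟨ *-identityʳ _ ⟨
      pow R ω (k % n) * 1#                        ≈⟨ *-congˡ (∣⇒pow≈1 ωⁿ≈1 (n∣m*n (k / n))) ⟨
      pow R ω (k % n) * pow R ω (k / n ℕ.* n)     ≈⟨ pow-+ ω (k % n) _ ⟨
      pow R ω (k % n ℕ.+ k / n ℕ.* n)             ≡⟨ ≡.cong (pow R ω) (m≡m%n+[m/n]*n k n) ⟨
      pow R ω k                                   ≈⟨ ωᵏ≈1 ⟩
      1#                                          ∎

  evalPoly-cong : ∀ f {x y} → x ≈ y → evalPoly R f x ≈ evalPoly R f y
  evalPoly-cong []      _   = refl
  evalPoly-cong (_ ∷ f) x≈y = +-congˡ (*-cong x≈y (evalPoly-cong f x≈y))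

  evalPoly-zeros++ : ∀ k f x → evalPoly R (replicate k (+ 0) ++ f) x ≈ pow R x k * evalPoly R f x
  evalPoly-zeros++ zero    f x = sym (*-identityˡ _)
  evalPoly-zeros++ (suc k) f x = begin
    0# + x * evalPoly R (replicate k (+ 0) ++ f) x   ≈⟨ +-identityˡ _ ⟩
    x * evalPoly R (replicate k (+ 0) ++ f) x        ≈⟨ *-congˡ (evalPoly-zeros++ k f x) ⟩
    x * (pow R x k * evalPoly R f x)                 ≈⟨ *-assoc _ _ _ ⟨
    x * pow R x k * evalPoly R f x                   ∎

  evalPoly-expand : ∀ m .{{_ : NonZero m}} f x → evalPoly R (expand m f) x ≈ evalPoly R f (pow R x m)
  evalPoly-expand (suc m) []      x = refl
  evalPoly-expand (suc m) (_ ∷ f) x = +-congˡ (begin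
    x * evalPoly R (replicate m (+ 0) ++ expand (suc m) f) x   ≈⟨ *-congˡ (evalPoly-zeros++ m _ x) ⟩
    x * (pow R x m * evalPoly R (expand (suc m) f) x)          ≈⟨ *-assoc _ _ _ ⟨
    pow R x (suc m) * evalPoly R (expand (suc m) f) x          ≈⟨ *-congˡ (evalPoly-expand (suc m) f x) ⟩
    pow R x (suc m) * evalPoly R f (pow R x (suc m))           ∎)

  evalPoly-Φ₁-1 : evalPoly R Φ₁ 1# ≈ 0#
  evalPoly-Φ₁-1 = begin
    - (1# + 0#) + 1# * ((1# + 0#) + 1# * 0#)   ≈⟨ +-congˡ (solve 0 (con 1 :* ((con 1 :+ con 0) :+ con 1 :* con 0) := con 1 :+ con 0) refl) ⟩
    - (1# + 0#) + (1# + 0#)                    ≈⟨ -‿inverseˡ _ ⟩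
    0#                                         ∎

  evalPoly-Φprime-1 : ∀ p → evalPoly R (Φprime p) 1# ≈ natR R p
  evalPoly-Φprime-1 zero    = refl
  evalPoly-Φprime-1 (suc p) = +-cong (+-identityʳ 1#) (trans (*-identityˡ _) (evalPoly-Φprime-1 p))

  -- (x - 1) Φ_p(x) = x^p - 1, stated without subtraction so that it is a semiring identity.
  Φprime-telescopes : ∀ p x → x * evalPoly R (Φprime p) x + 1# ≈ evalPoly R (Φprime p) x + pow R x p
  Φprime-telescopes zero    x = +-congʳ (zeroʳ x)
  Φprime-telescopes (suc p) x = begin
    x * ((1# + 0#) + x * Φ) + 1#
      ≈⟨ solve 2 (λ x Φ → x :* ((con 1 :+ con 0) :+ x :* Φ) :+ con 1 := (con 1 :+ con 0) :+ x :* (x :* Φ :+ con 1)) refl x Φ ⟩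
    (1# + 0#) + x * (x * Φ + 1#)       ≈⟨ +-congˡ (*-congˡ (Φprime-telescopes p x)) ⟩
    (1# + 0#) + x * (Φ + pow R x p)
      ≈⟨ solve 3 (λ x Φ y → (con 1 :+ con 0) :+ x :* (Φ :+ y) := ((con 1 :+ con 0) :+ x :* Φ) :+ x :* y) refl x Φ (pow R x p) ⟩
    ((1# + 0#) + x * Φ) + x * pow R x p ∎
    where Φ = evalPoly R (Φprime p) x

  evalPoly-Φprime-root : IntegralDomain R → ∀ p {x} → pow R x p ≈ 1# → ¬ x ≈ 1# → evalPoly R (Φprime p) x ≈ 0#
  evalPoly-Φprime-root domain p {x} xᵖ≈1 x≉1 = x*y≈y⇒y≈0 domain xΦ≈Φ x≉1
    where
    xΦ≈Φ : x * evalPoly R (Φprime p) x ≈ evalPoly R (Φprime p) x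
    xΦ≈Φ = +-cancelʳ 1# _ _ (trans (Φprime-telescopes p x) (+-congˡ xᵖ≈1))

  module _ {n p m ω} .{{_ : NonZero n}} (ω-primitive : PrimitiveRoot R n ω) (n≡pm : p ℕ.* m ≡ n) where
    private instance
      m≢0 : NonZero m
      m≢0 = cofactor-nonZero p m n≡pm

    expand-Φprime-at-root : ∀ i → evalPoly R (expand m (Φprime p)) (pow R ω i) ≈ evalPoly R (Φprime p) (pow R ω (i ℕ.* m))
    expand-Φprime-at-root i = trans (evalPoly-expand m (Φprime p) (pow R ω i)) (evalPoly-cong (Φprime p) (pow-assocʳ ω i m))

    expand-Φprime-at-root-∣ : ∀ {i} → p ∣ i → evalPoly R (expand m (Φprime p)) (pow R ω i) ≈ natR R p
    expand-Φprime-at-root-∣ {i} p∣i = begin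
      evalPoly R (expand m (Φprime p)) (pow R ω i)   ≈⟨ expand-Φprime-at-root i ⟩
      evalPoly R (Φprime p) (pow R ω (i ℕ.* m))      ≈⟨ evalPoly-cong (Φprime p) ω^[im]≈1 ⟩
      evalPoly R (Φprime p) 1#                       ≈⟨ evalPoly-Φprime-1 p ⟩
      natR R p                                       ∎
      where
      ω^[im]≈1 : pow R ω (i ℕ.* m) ≈ 1#
      ω^[im]≈1 = ∣⇒pow≈1 (proj₁ ω-primitive) (≡.subst (_∣ i ℕ.* m) n≡pm (*-monoˡ-∣ m p∣i))

    expand-Φprime-at-root-∤ : IntegralDomain R → ∀ {i} → ¬ p ∣ i → evalPoly R (expand m (Φprime p)) (pow R ω i) ≈ 0#
    expand-Φprime-at-root-∤ domain {i} p∤i =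
      trans (expand-Φprime-at-root i) (evalPoly-Φprime-root domain p yᵖ≈1 y≉1)
      where
      y : Carrier
      y = pow R ω (i ℕ.* m)

      yᵖ≈1 : pow R y p ≈ 1#
      yᵖ≈1 = trans (pow-assocʳ ω (i ℕ.* m) p)
        (∣⇒pow≈1 (proj₁ ω-primitive) (≡.subst (_∣ i ℕ.* m ℕ.* p) (≡.trans (ℕₚ.*-comm m p) n≡pm) (*-monoˡ-∣ p (n∣m*n i))))

      y≉1 : ¬ y ≈ 1#
      y≉1 y≈1 = p∤i (*-cancelʳ-∣ m (≡.subst (_∣ i ℕ.* m) (≡.sym n≡pm) (primitive-pow≈1⇒∣ ω-primitive y≈1)))

module _ {a ℓ} (R : CommutativeRing a ℓ) (domain : IntegralDomain R) {c : ℕ → ℕ} (X : ActionSeq c)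
         (c1≡0 : c 1 ≡ 0) (cp≡p : ∀ p → Prime p → c p ≡ p) where
  open CommutativeRing R
  open import Relation.Binary.Reasoning.Setoid setoid

  c∘gcd≈expand-Φprime-at-root : ∀ {n p m ω} .{{_ : NonZero n}} → PrimitiveRoot R n ω → Prime p → p ℕ.* m ≡ n →
                                ∀ i → natR R (c (gcd p i)) ≈ evalPoly R (expand m (Φprime p)) (pow R ω i)
  c∘gcd≈expand-Φprime-at-root {p = p} {m} {ω} ω-primitive p-prime n≡pm i with p ∣? i
  ... | yes p∣i = begin
    natR R (c (gcd p i))   ≡⟨ ≡.cong (natR R ∘ c) (m∣n⇒gcd[m,n]≡m p∣i) ⟩
    natR R (c p)           ≡⟨ ≡.cong (natR R) (cp≡p p p-prime) ⟩
    natR R p               ≈⟨ expand-Φprime-at-root-∣ R ω-primitive n≡pm p∣i ⟨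
    evalPoly R (expand m (Φprime p)) (pow R ω i) ∎
  ... | no p∤i = begin
    natR R (c (gcd p i))   ≡⟨ ≡.cong (natR R ∘ c) (prime∤⇒gcd≡1 p-prime p∤i) ⟩
    natR R (c 1)           ≡⟨ ≡.cong (natR R) c1≡0 ⟩
    0#                     ≈⟨ expand-Φprime-at-root-∤ R ω-primitive n≡pm domain p∤i ⟨
    evalPoly R (expand m (Φprime p)) (pow R ω i) ∎

  csp-PolyOf : (t : ℕ → ℕ) → (∀ n → 1 < n → PrimeFactorOf n (t n)) →
               FixHyp c X t → ∀ n .{{_ : NonZero n}} → CSP R n (X n) (PolyOf t n)
  -- For n = 1 FixHyp only speaks about the junk value c (gcd (t 1) 0); X 1 is empty instead.
  csp-PolyOf t t-primeFactor fix 1 ω _ Fin.zero = begin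
    natR R (fixCount (X 1) Fin.zero)   ≡⟨ ≡.cong (natR R) (fixCount-empty (X 1) Fin.zero c1≡0) ⟩
    0#                                 ≈⟨ evalPoly-Φ₁-1 R ⟨
    evalPoly R Φ₁ 1#                   ∎
  csp-PolyOf t t-primeFactor fix n@(suc (suc _)) ω ω-primitive i = begin
    natR R (fixCount (X n) i)          ≡⟨ ≡.cong (natR R) (fix n i) ⟩
    natR R (c (gcd (t n) (toℕ i)))     ≈⟨ c∘gcd≈expand-Φprime-at-root ω-primitive (proj₁ pf) (p*quot≡n pf) (toℕ i) ⟩
    evalPoly R (PolyOf t n) (pow R ω (toℕ i)) ∎
    where
    pf : PrimeFactorOf n (t n)
    pf = t-primeFactor n (s≤s (s≤s z≤n))

corollary3 : ∀ {a ℓ : Level} (R : CommutativeRing a ℓ) →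
             IntegralDomain R → CharZero R →
             (c : ℕ → ℕ) (X : ActionSeq c) →
             c 1 ≡ 0 →
             (∀ p → Prime p → c p ≡ p) →
             (FixHyp c X s → ∀ n .{{_ : NonZero n}} → CSP R n (X n) (S n))
             × (FixHyp c X g → ∀ n .{{_ : NonZero n}} → CSP R n (X n) (G n))
corollary3 R domain _ c X c1≡0 cp≡p =
  csp-PolyOf R domain X c1≡0 cp≡p s s-primeFactor , csp-PolyOf R domain X c1≡0 cp≡p g g-primeFactor
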